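{- Let $t$ be an ordinary $\lambda$-term and $x$ a variable with $t\sqsubseteq_{\mathcal{B}\eta_{\mathrm{red}}}x$. (1) If $\Gamma\vdash^kt^\bullet:L$ is derivable, then there exist linear types $L',L''$ such that $\Gamma=x:[L']$, $L''\le^-_{k'}L'$ and $L''\le^+_{k''}L$ with $k=k'+k''$. (2) If $\Gamma\vdash^kt^\bullet:M$ is derivable (for a multi type $M$), then there exist multi types $M',M''$ such that $\Gamma=x:M'$, $M''\le^-_{k'}M'$ and $M''\le^+_{k''}M$ with $k=k'+k''$.
   Context: $\sqsubseteq_{\mathcal{B}\eta_{\mathrm{red}}}$ on ordinary $\lambda$-terms is the largest relation such that $t\sqsubseteq_{\mathcal{B}\eta_{\mathrm{red}}}u$ implies either $t$ has no head normal form, or $t$ has head normal form $\lambda x_1\ldots x_{n+p}.y\,t_1\cdots t_{k+p}$ and $u$ has head normal form $\lambda x_1\ldots x_n.y\,u_1\cdots u_k$ with $p\ge0$, $y$ equally bound or free in both, $t_i\sqsubseteq u_i$ ($i\le k$), $t_i\sqsubseteq x_i$ ($k<i\le k+p$), and $x_{k+1},\ldots,x_{k+p}$ not free in $y\,u_1\cdots u_k$. Checkers terms: $t ::= x\mid\lambda_cx.t\mid t\cdot^cu$, $c\in\{\circ,\bullet\}$. Black painting: $x^\bullet=x$, $(\lambda x.t)^\bullet=\lambda_\bullet x.t^\bullet$, $(tu)^\bullet=t^\bullet\cdot^\bullet u^\bullet$. Types: linear $L ::= X\mid M\to_cL$; multi $M ::= [L_1,\ldots,L_n]$; environments $\Gamma$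 (finite support), pointwise $+$, $\Gamma,x:M$ with $x\notin\mathrm{supp}(\Gamma)$; $x:M$ denotes the environment mapping $x$ to $M$ and all other variables to $[\,]$. Rules: (ax) $x:[L]\vdash^0x:L$; (many) from $\Gamma_i\vdash^{k_i}t:L_i$ ($i\in I$ finite) infer $\sum\Gamma_i\vdash^{\sum k_i}t:[L_i]_{i\in I}$; ($\lambda$) from $\Gamma,x:M\vdash^kt:L$ infer $\Gamma\vdash^k\lambda_cx.t:M\to_cL$; (@) from $\Gamma\vdash^{k_1}t:M\to_cL$ and $\Delta\vdash^{k_2}u:M$ infer $\Gamma+\Delta\vdash^kt\cdot^du:L$, $k=k_1+k_2$ if $c=d$, else $k_1+k_2+1$. Polarized whitening $\le^a_k$ ($a\in\{+,-\}$, $\bar a$ opposite), on linear and multi types by mutual induction: $X\le^a_0X$; if $M'\le^-_{k_1}M$, $L'\le^+_{k_2}L$ then $(M'\to_\circ L')\le^+_{k_1+k_2+1}(M\to_\bullet L)$; for any $c$, if $M'\le^{\bar a}_{k_1}M$, $L'\le^a_{k_2}L$ then $(M'\to_cL')\le^a_{k_1+k_2}(M\to_cL)$; $[L'_i]_{i\le n}\le^a_{\sum k_i}[L_i]_{i\le n}$ when $L'_i\le^a_{k_i}L_i$; no other rules. -}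

module Defs where

open import Data.Nat using (ℕ; zero; suc; _+_; _≡ᵇ_)
open import Data.Bool using (if_then_else_)
open import Data.List using (List; []; _∷_; _++_; map; downFrom; foldl)
open import Data.List.Relation.Binary.Pointwise using (Pointwise)
open import Data.Product using (Σ; _×_; ∃; _,_)
open import Data.Sum using (_⊎_)
open import Relation.Nullary using (¬_)
open import Relation.Binary.PropositionalEquality using (_≡_)
open import Relation.Binary.Construct.Closure.ReflexiveTransitive using (Star)

-- Ordinary λ-terms (de Bruijn indices; free variable x is index x at top)

data Term : Set where
  var : ℕ → Term
  lam : Term → Term
  app : Term → Term → Term

ext : (ℕ → ℕ) → ℕ → ℕ
ext ρ zero    = zero
ext ρ (suc n) = suc (ρ n)

rename : (ℕ → ℕ) → Term → Term
rename ρ (var n)   = var (ρ n)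
rename ρ (lam t)   = lam (rename (ext ρ) t)
rename ρ (app t u) = app (rename ρ t) (rename ρ u)

exts : (ℕ → Term) → ℕ → Term
exts σ zero    = var zero
exts σ (suc n) = rename suc (σ n)

subst : (ℕ → Term) → Term → Term
subst σ (var n)   = σ n
subst σ (lam t)   = lam (subst (exts σ) t)
subst σ (app t u) = app (subst σ t) (subst σ u)

subst0 : Term → ℕ → Term
subst0 u zero    = u
subst0 u (suc n) = var n

_[_] : Term → Term → Term
t [ u ] = subst (subst0 u) t

data _→β_ : Term → Term → Set where
  β    : ∀ {t u} → app (lam t) u →β (t [ u ])
  ξlam : ∀ {t t'} → t →β t' → lam t →β lam t'
  ξl   : ∀ {t t' u} → t →β t' → app t u →β app t' u
  ξr   : ∀ {t u u'} → u →β u' → app t u →β app t u'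

_→β*_ : Term → Term → Set
_→β*_ = Star _→β_

weaken : ℕ → Term → Term
weaken p = rename (λ i → p + i)

lams : ℕ → Term → Term
lams zero    t = t
lams (suc n) t = lam (lams n t)

apps : Term → List Term → Term
apps = foldl app

hnf : ℕ → ℕ → List Term → Term
hnf n y ts = lams n (apps (var y) ts)

HasHNF : Term → Set
HasHNF t = Σ ℕ λ n → Σ ℕ λ y → Σ (List Term) λ ts → t →β* hnf n y ts

-- The functional whose post-fixed points are the Bη_red-simulations.
-- t has hnf λx₁…x_{n+p}. y t₁⋯t_{k+p}  (ts = ts₁ ++ ts₂, |ts₁| = k, |ts₂| = p)
-- u has hnf λx₁…xₙ. y u₁⋯u_k ; in de Bruijn notation the head of t is
-- y + p (same variable, under p more binders); u_i are weakened by p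
-- (this encodes that x_{n+1},…,x_{n+p} are not free in y u₁⋯u_k);
-- x_{n+1},…,x_{n+p} are the indices p-1,…,0 (= downFrom p).
Step : (Term → Term → Set) → Term → Term → Set
Step R t u =
  (¬ HasHNF t) ⊎
  (Σ ℕ λ n → Σ ℕ λ p → Σ ℕ λ y →
   Σ (List Term) λ ts₁ → Σ (List Term) λ ts₂ → Σ (List Term) λ us →
     (t →β* hnf (n + p) (y + p) (ts₁ ++ ts₂)) ×
     (u →β* hnf n y us) ×
     Pointwise R ts₁ (map (weaken p) us) ×
     Pointwise R ts₂ (map var (downFrom p)))

PostFixed : (Term → Term → Set) → Set
PostFixed R = ∀ t u → R t u → Step R t u

-- the largest such relation: union of all post-fixed points
_⊑Bη_ : Term → Term → Set₁
t ⊑Bη u = Σ (Term → Term → Set) λ R → PostFixed R × R t u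

data Color : Set where
  ∘ • : Color

data CTerm : Set where
  cvar : ℕ → CTerm
  clam : Color → CTerm → CTerm
  capp : Color → CTerm → CTerm → CTerm

paint : Term → CTerm
paint (var n)   = cvar n
paint (lam t)   = clam • (paint t)
paint (app t u) = capp • (paint t) (paint u)

-- Types: multi types are finite multisets, represented by lists;
-- all relations below are invariant under (nested) permutation.

data LType : Set where
  tv  : ℕ → LType
  arr : List LType → Color → LType → LType

MType : Set
MType = List LType

mutual
  data _≈L_ : LType → LType → Set where
    tv≈  : ∀ {X} → tv X ≈L tv X
    arr≈ : ∀ {M M' c L L'} → M ≈M M' → L ≈L L' → arr M c L ≈L arr M' c L'

  data _≈M_ : MType → MType → Set where
    []≈ : [] ≈M []
    ∷≈  : ∀ {L L' M N₁ N₂} → L ≈L L' → M ≈M (N₁ ++ N₂) →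
          (L ∷ M) ≈M (N₁ ++ L' ∷ N₂)

Env : Set
Env = ℕ → MType

empty : Env
empty _ = []

_+ᵉ_ : Env → Env → Env
(Γ +ᵉ Δ) y = Γ y ++ Δ y

_∶_ : ℕ → MType → Env
(x ∶ M) y = if y ≡ᵇ x then M else []

drop0 : Env → Env
drop0 Γ y = Γ (suc y)

cost : Color → Color → ℕ → ℕ
cost ∘ ∘ k = k
cost • • k = k
cost ∘ • k = suc k
cost • ∘ k = suc k

mutual
  data _⊢[_]_∶L_ : Env → ℕ → CTerm → LType → Set where
    ax  : ∀ {x L} → (x ∶ (L ∷ [])) ⊢[ 0 ] cvar x ∶L L
    lm  : ∀ {Γ k t L c} → Γ ⊢[ k ] t ∶L L →
          drop0 Γ ⊢[ k ] clam c t ∶L arr (Γ 0) c L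
    ap  : ∀ {Γ Δ k₁ k₂ t u M M' c d L} →
          Γ ⊢[ k₁ ] t ∶L arr M c L → Δ ⊢[ k₂ ] u ∶M M' → M' ≈M M →
          (Γ +ᵉ Δ) ⊢[ cost c d (k₁ + k₂) ] capp d t u ∶L L

  data _⊢[_]_∶M_ : Env → ℕ → CTerm → MType → Set where
    many[] : ∀ {t} → empty ⊢[ 0 ] t ∶M []
    many∷  : ∀ {Γ Δ k₁ k₂ t L M} → Γ ⊢[ k₁ ] t ∶L L → Δ ⊢[ k₂ ] t ∶M M →
             (Γ +ᵉ Δ) ⊢[ k₁ + k₂ ] t ∶M (L ∷ M)

data Pol : Set where
  pos neg : Pol

flip : Pol → Pol
flip pos = neg
flip neg = pos

mutual
  data _≤L[_,_]_ : LType → Pol → ℕ → LType → Set where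
    wX    : ∀ {X a} → tv X ≤L[ a , 0 ] tv X
    wWhite : ∀ {M' M L' L k₁ k₂} → M' ≤M[ neg , k₁ ] M → L' ≤L[ pos , k₂ ] L →
             arr M' ∘ L' ≤L[ pos , suc (k₁ + k₂) ] arr M • L
    wArr  : ∀ {M' M L' L k₁ k₂ a c} → M' ≤M[ flip a , k₁ ] M → L' ≤L[ a , k₂ ] L →
            arr M' c L' ≤L[ a , k₁ + k₂ ] arr M c L

  data _≤M[_,_]_ : MType → Pol → ℕ → MType → Set where
    w[] : ∀ {a} → [] ≤M[ a , 0 ] []
    w∷  : ∀ {L' L M' N₁ N₂ a k₁ k₂} → L' ≤L[ a , k₁ ] L → M' ≤M[ a , k₂ ] (N₁ ++ N₂) →
          (L' ∷ M') ≤M[ a , k₁ + k₂ ] (N₁ ++ L ∷ N₂)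

-- A term t below a variable x, once it has a head normal form, reduces to an η-expansion
-- λy₁…y_p. x t₁ ⋯ t_p with each t_i again below y_i. Typings of t• survive β-reduction with
-- non-increasing derivation size, strictly decreasing along head reduction, so a typed t has a
-- head normal form and its typing carries over to that η-expansion. There the head x gets a type
-- N₁ →c₁ ⋯ N_p →c_p L₀ and the abstraction a type N′₁ →• ⋯ N′_p →• L₀, where, by induction on
-- the size, the argument t_i of type N_i lives in the environment y_i : N′_i with a common
-- whitening of N′_i and N_i. Assembling these arrow by arrow gives a common whitening of the
-- type of x and the type of t; the extra cost of a white application (c_i = ∘) is exactly the
-- cost of the white-to-black step of the positive whitening.

{-# OPTIONS --safe #-}
module Submission where

open import Defs
open import Algebra.Bundles using (CommutativeSemigroup)
import Algebra.Properties.CommutativeSemigroup as CommutativeSemigroupProperties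
open import Data.Bool using (true; false)
open import Data.Empty using (⊥-elim)
open import Data.List using (List; []; _∷_; _++_; map; downFrom)
open import Data.List.Properties using (∷-injective; ++-assoc; ++-identityʳ; foldl-∷ʳ)
open import Data.List.Relation.Binary.Pointwise using (Pointwise; []; _∷_)
open import Data.Nat using (ℕ; zero; suc; _+_; _≤_; _<_; s≤s; _≡ᵇ_; _≟_)
open import Data.Nat.Induction using (<-wellFounded)
open import Data.Nat.Properties
  using (+-assoc; +-comm; +-suc; +-identityʳ; +-commutativeSemigroup; +-mono-≤; +-monoˡ-≤; +-monoʳ-≤;
         ≤-refl; ≤-reflexive; ≤-trans; <-≤-trans; ≤-pred; <⇒≤; n≤1+n; m≤n⇒m≤1+n; m≤m+n; m≤n+m;
         <⇒≢; >⇒≢; suc-injective)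
open import Data.Nat.Tactic.RingSolver using (solve-∀)
open import Data.Product using (Σ; _×_; _,_)
open import Data.Sum using (_⊎_; inj₁; inj₂)
open import Data.Unit using (⊤; tt)
open import Induction.WellFounded using (Acc; acc)
open import Level using (0ℓ)
open import Relation.Binary.Construct.Closure.ReflexiveTransitive using (ε; _◅_)
open import Relation.Binary.Definitions using (Reflexive; Symmetric; Transitive)
open import Relation.Binary.PropositionalEquality as ≡
  using (_≡_; _≢_; refl; sym; trans; cong; cong₂; ≢-sym; module ≡-Reasoning)
open import Relation.Nullary using (yes; no)

module ℕ+ = CommutativeSemigroupProperties +-commutativeSemigroup

split-++-∷ : ∀ {A : Set} (xs₁ : List A) {x : A} {xs₂} (ys₁ : List A) {ys₂} →
  xs₁ ++ x ∷ xs₂ ≡ ys₁ ++ ys₂ →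
  (Σ (List A) λ zs → ys₁ ≡ xs₁ ++ x ∷ zs × xs₂ ≡ zs ++ ys₂) ⊎
  (Σ (List A) λ zs → ys₂ ≡ zs ++ x ∷ xs₂ × xs₁ ≡ ys₁ ++ zs)
split-++-∷ xs₁        []        eq   = inj₂ (xs₁ , sym eq , refl)
split-++-∷ []         (y ∷ ys₁) refl = inj₁ (ys₁ , refl , refl)
split-++-∷ (x′ ∷ xs₁) (y ∷ ys₁) eq with ∷-injective eq
... | refl , eq′ with split-++-∷ xs₁ ys₁ eq′
...   | inj₁ (zs , refl , e) = inj₁ (zs , refl , e)
...   | inj₂ (zs , e , refl) = inj₂ (zs , e , refl)

-- Multiset equality of types

mutual
  ≈L-refl : Reflexive _≈L_
  ≈L-refl {tv X}      = tv≈
  ≈L-refl {arr M c L} = arr≈ ≈M-refl ≈L-refl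

  ≈M-refl : Reflexive _≈M_
  ≈M-refl {[]}    = []≈
  ≈M-refl {L ∷ M} = ∷≈ {N₁ = []} ≈L-refl ≈M-refl

≈M-reflexive : ∀ {M N} → M ≡ N → M ≈M N
≈M-reflexive refl = ≈M-refl

≈M-remove : ∀ N₁ {L N₂ K} → (N₁ ++ L ∷ N₂) ≈M K →
  Σ (List LType) λ K₁ → Σ LType λ L′ → Σ (List LType) λ K₂ →
    K ≡ K₁ ++ L′ ∷ K₂ × L ≈L L′ × (N₁ ++ N₂) ≈M (K₁ ++ K₂)
≈M-remove []       (∷≈ {N₁ = P₁} {N₂ = P₂} e r) = P₁ , _ , P₂ , refl , e , r
≈M-remove (A ∷ N₁) (∷≈ {L' = A′} {N₁ = P₁} {N₂ = P₂} e r) with ≈M-remove N₁ r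
... | Q₁ , L′ , Q₂ , eq , e′ , r′ with split-++-∷ Q₁ P₁ (sym eq)
...   | inj₁ (C , refl , refl) =
  Q₁ , L′ , C ++ A′ ∷ P₂ , ++-assoc Q₁ (L′ ∷ C) (A′ ∷ P₂) , e′ ,
  ≡.subst (_ ≈M_) (++-assoc Q₁ C (A′ ∷ P₂))
    (∷≈ {N₁ = Q₁ ++ C} e (≡.subst (_ ≈M_) (sym (++-assoc Q₁ C P₂)) r′))
...   | inj₂ (B , refl , refl) =
  P₁ ++ A′ ∷ B , L′ , Q₂ , sym (++-assoc P₁ (A′ ∷ B) (L′ ∷ Q₂)) , e′ ,
  ≡.subst (_ ≈M_) (sym (++-assoc P₁ (A′ ∷ B) Q₂))
    (∷≈ {N₁ = P₁} e (≡.subst (_ ≈M_) (++-assoc P₁ B Q₂) r′))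

mutual
  ≈L-trans : Transitive _≈L_
  ≈L-trans tv≈        tv≈          = tv≈
  ≈L-trans (arr≈ m l) (arr≈ m′ l′) = arr≈ (≈M-trans m m′) (≈L-trans l l′)

  ≈M-trans : Transitive _≈M_
  ≈M-trans []≈                []≈ = []≈
  ≈M-trans (∷≈ {N₁ = N₁} e r) q with ≈M-remove N₁ q
  ... | _ , _ , _ , refl , e′ , r′ = ∷≈ (≈L-trans e e′) (≈M-trans r r′)

≈M-insert : ∀ N₁ {N₂ M L L′} → (N₁ ++ N₂) ≈M M → L′ ≈L L → (N₁ ++ L′ ∷ N₂) ≈M (L ∷ M)
≈M-insert []       r                  e = ∷≈ {N₁ = []} e r
≈M-insert (A ∷ N₁) (∷≈ {N₁ = P₁} a r) e = ∷≈ {N₁ = _ ∷ P₁} a (≈M-insert N₁ r e)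

mutual
  ≈L-sym : Symmetric _≈L_
  ≈L-sym tv≈        = tv≈
  ≈L-sym (arr≈ m l) = arr≈ (≈M-sym m) (≈L-sym l)

  ≈M-sym : Symmetric _≈M_
  ≈M-sym []≈                = []≈
  ≈M-sym (∷≈ {N₁ = N₁} e r) = ≈M-insert N₁ (≈M-sym r) (≈L-sym e)

≈M-++⁺ : ∀ {M₁ N₁ M₂ N₂} → M₁ ≈M N₁ → M₂ ≈M N₂ → (M₁ ++ M₂) ≈M (N₁ ++ N₂)
≈M-++⁺ []≈ q = q
≈M-++⁺ {N₂ = N₂} (∷≈ {N₁ = P₁} {N₂ = P₂} e r) q =
  ≡.subst (_ ≈M_) (sym (++-assoc P₁ (_ ∷ P₂) N₂))
    (∷≈ {N₁ = P₁} e (≡.subst (_ ≈M_) (++-assoc P₁ P₂ N₂) (≈M-++⁺ r q)))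

≈M-++-comm : ∀ M₁ M₂ → (M₁ ++ M₂) ≈M (M₂ ++ M₁)
≈M-++-comm []       M₂ = ≈M-reflexive (sym (++-identityʳ M₂))
≈M-++-comm (L ∷ M₁) M₂ = ∷≈ {N₁ = M₂} ≈L-refl (≈M-++-comm M₁ M₂)

≈M-[]ˡ : ∀ {M} → [] ≈M M → M ≡ []
≈M-[]ˡ []≈ = refl

≈M-[]ʳ : ∀ {M} → M ≈M [] → M ≡ []
≈M-[]ʳ e = ≈M-[]ˡ (≈M-sym e)

≈M-[-]ʳ : ∀ {M L} → M ≈M (L ∷ []) → Σ LType λ L₀ → M ≡ L₀ ∷ [] × L₀ ≈L L
≈M-[-]ʳ e with ≈M-sym e
... | ∷≈ {N₁ = []}    e′ r with ≈M-[]ˡ r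
...   | refl = _ , refl , ≈L-sym e′
≈M-[-]ʳ e | ∷≈ {N₁ = _ ∷ _} e′ r with ≈M-[]ˡ r
...   | ()

-- Whitening

cost-•-+ : ∀ c m n → cost c • m + n ≡ cost c • (m + n)
cost-•-+ ∘ m n = refl
cost-•-+ • m n = refl

+-cost-• : ∀ c m n → m + cost c • n ≡ cost c • (m + n)
+-cost-• ∘ m n = +-suc m n
+-cost-• • m n = refl

mutual
  ≤L-refl : ∀ a L → L ≤L[ a , 0 ] L
  ≤L-refl a (tv X)      = wX
  ≤L-refl a (arr M c L) = wArr (≤M-refl (flip a) M) (≤L-refl a L)

  ≤M-refl : ∀ a M → M ≤M[ a , 0 ] M
  ≤M-refl a []      = w[]
  ≤M-refl a (L ∷ M) = w∷ {N₁ = []} (≤L-refl a L) (≤M-refl a M)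

mutual
  ≤L-respʳ-≈L : ∀ {a k L″ L L₀} → L ≈L L₀ → L″ ≤L[ a , k ] L → L″ ≤L[ a , k ] L₀
  ≤L-respʳ-≈L tv≈          wX           = wX
  ≤L-respʳ-≈L (arr≈ m′ l′) (wWhite m l) = wWhite (≤M-respʳ-≈M m′ m) (≤L-respʳ-≈L l′ l)
  ≤L-respʳ-≈L (arr≈ m′ l′) (wArr m l)   = wArr (≤M-respʳ-≈M m′ m) (≤L-respʳ-≈L l′ l)

  ≤M-respʳ-≈M : ∀ {a k M″ M M₀} → M ≈M M₀ → M″ ≤M[ a , k ] M → M″ ≤M[ a , k ] M₀
  ≤M-respʳ-≈M q w[] with ≈M-[]ˡ q
  ... | refl = w[]
  ≤M-respʳ-≈M q (w∷ {N₁ = N₁} l m) with ≈M-remove N₁ q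
  ... | _ , _ , _ , refl , e′ , r′ = w∷ (≤L-respʳ-≈L e′ l) (≤M-respʳ-≈M r′ m)

arrs• : List MType → LType → LType
arrs• []       L = L
arrs• (A ∷ As) L = arr A • (arrs• As L)

arrs•-cong : ∀ {As Bs L} → Pointwise _≈M_ As Bs → arrs• As L ≈L arrs• Bs L
arrs•-cong []       = ≈L-refl
arrs•-cong (q ∷ qs) = arr≈ q (arrs•-cong qs)

whiten-arr⁺ : ∀ c {N″ N′ R″ R k₁ k₂} → N″ ≤M[ neg , k₁ ] N′ → R″ ≤L[ pos , k₂ ] R →
  arr N″ c R″ ≤L[ pos , cost c • (k₁ + k₂) ] arr N′ • R
whiten-arr⁺ ∘ = wWhite
whiten-arr⁺ • = wArr

CommonWhiteningL : LType → ℕ → LType → Set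
CommonWhiteningL L′ k L = Σ LType λ L″ → Σ ℕ λ k′ → Σ ℕ λ k″ →
  L″ ≤L[ neg , k′ ] L′ × L″ ≤L[ pos , k″ ] L × k ≡ k′ + k″

CommonWhiteningM : MType → ℕ → MType → Set
CommonWhiteningM M′ k M = Σ MType λ M″ → Σ ℕ λ k′ → Σ ℕ λ k″ →
  M″ ≤M[ neg , k′ ] M′ × M″ ≤M[ pos , k″ ] M × k ≡ k′ + k″

commonWhiteningL-refl : ∀ L → CommonWhiteningL L 0 L
commonWhiteningL-refl L = L , 0 , 0 , ≤L-refl neg L , ≤L-refl pos L , refl

commonWhiteningL-respˡ : ∀ {L′ L₀ k L} → L′ ≈L L₀ → CommonWhiteningL L′ k L → CommonWhiteningL L₀ k L
commonWhiteningL-respˡ q (L″ , k′ , k″ , n , p , eq) = L″ , k′ , k″ , ≤L-respʳ-≈L q n , p , eq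

commonWhiteningL-respʳ : ∀ {L′ k L L₀} → L ≈L L₀ → CommonWhiteningL L′ k L → CommonWhiteningL L′ k L₀
commonWhiteningL-respʳ q (L″ , k′ , k″ , n , p , eq) = L″ , k′ , k″ , n , ≤L-respʳ-≈L q p , eq

commonWhiteningM-respˡ : ∀ {M′ M₀ k M} → M′ ≈M M₀ → CommonWhiteningM M′ k M → CommonWhiteningM M₀ k M
commonWhiteningM-respˡ q (M″ , k′ , k″ , n , p , eq) = M″ , k′ , k″ , ≤M-respʳ-≈M q n , p , eq

commonWhiteningM-[] : CommonWhiteningM [] 0 []
commonWhiteningM-[] = [] , 0 , 0 , w[] , w[] , refl

commonWhiteningM-∷ : ∀ N₁ {N₂ L′ L M′ k₁ k₂} →
  CommonWhiteningL L′ k₁ L → CommonWhiteningM M′ k₂ (N₁ ++ N₂) →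
  CommonWhiteningM (L′ ∷ M′) (k₁ + k₂) (N₁ ++ L ∷ N₂)
commonWhiteningM-∷ N₁ (L″ , a′ , a″ , n₁ , p₁ , refl) (M″ , b′ , b″ , n₂ , p₂ , refl) =
  L″ ∷ M″ , a′ + b′ , a″ + b″ , w∷ {N₁ = []} n₁ n₂ , w∷ {N₁ = N₁} p₁ p₂ , ℕ+.interchange a′ a″ b′ b″

-- One η-expansion step: the fresh argument, of type N′ in the abstraction, is whitened
-- into the argument type N of the head, and a white arrow of the head costs one more.
commonWhiteningL-arr : ∀ c {N′ N H R k₁ k₂} →
  CommonWhiteningM N′ k₁ N → CommonWhiteningL H k₂ R →
  CommonWhiteningL (arr N c H) (cost c • (k₁ + k₂)) (arr N′ • R)
commonWhiteningL-arr c (N″ , a′ , a″ , n₁ , p₁ , refl) (R″ , b′ , b″ , n₂ , p₂ , refl) =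
  arr N″ c R″ , a″ + b′ , cost c • (a′ + b″) , wArr p₁ n₂ , whiten-arr⁺ c n₁ p₂ , cost-eq
  where
  shuffle : ∀ a′ a″ b′ b″ → (a′ + a″) + (b′ + b″) ≡ (a″ + b′) + (a′ + b″)
  shuffle = solve-∀
  cost-eq : cost c • ((a′ + a″) + (b′ + b″)) ≡ (a″ + b′) + cost c • (a′ + b″)
  cost-eq = trans (cong (cost c •) (shuffle a′ a″ b′ b″)) (sym (+-cost-• c (a″ + b′) (a′ + b″)))

-- Environments up to multiset equality

infix 4 _≈E_

_≈E_ : Env → Env → Set
Γ ≈E Δ = ∀ y → Γ y ≈M Δ y

≈E-refl : Reflexive _≈E_
≈E-refl y = ≈M-refl

≈E-sym : Symmetric _≈E_
≈E-sym e y = ≈M-sym (e y)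

≈E-trans : Transitive _≈E_
≈E-trans e f y = ≈M-trans (e y) (f y)

≈E-reflexive : ∀ {Γ Δ} → (∀ y → Γ y ≡ Δ y) → Γ ≈E Δ
≈E-reflexive e y = ≈M-reflexive (e y)

+ᵉ-cong : ∀ {Γ Γ′ Δ Δ′} → Γ ≈E Γ′ → Δ ≈E Δ′ → (Γ +ᵉ Δ) ≈E (Γ′ +ᵉ Δ′)
+ᵉ-cong e f y = ≈M-++⁺ (e y) (f y)

+ᵉ-assoc : ∀ Γ Δ Θ → ((Γ +ᵉ Δ) +ᵉ Θ) ≈E (Γ +ᵉ (Δ +ᵉ Θ))
+ᵉ-assoc Γ Δ Θ y = ≈M-reflexive (++-assoc (Γ y) (Δ y) (Θ y))

+ᵉ-identityʳ : ∀ {Γ} → (Γ +ᵉ empty) ≈E Γ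
+ᵉ-identityʳ {Γ} y = ≈M-reflexive (++-identityʳ (Γ y))

+ᵉ-commutativeSemigroup : CommutativeSemigroup 0ℓ 0ℓ
+ᵉ-commutativeSemigroup = record
  { Carrier                = Env
  ; _≈_                    = _≈E_
  ; _∙_                    = _+ᵉ_
  ; isCommutativeSemigroup = record
    { isSemigroup = record
      { isMagma = record
        { isEquivalence = record { refl = ≈E-refl ; sym = ≈E-sym ; trans = ≈E-trans }
        ; ∙-cong        = +ᵉ-cong
        }
      ; assoc = +ᵉ-assoc
      }
    ; comm = λ Γ Δ y → ≈M-++-comm (Γ y) (Δ y)
    }
  }

module +ᵉ = CommutativeSemigroupProperties +ᵉ-commutativeSemigroup

∶-self : ∀ x M → (x ∶ M) x ≡ M
∶-self zero    M = refl
∶-self (suc x) M = ∶-self x M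

∶-other : ∀ {x y} M → y ≢ x → (x ∶ M) y ≡ []
∶-other {zero}  {zero}  M y≢x = ⊥-elim (y≢x refl)
∶-other {zero}  {suc y} M y≢x = refl
∶-other {suc x} {zero}  M y≢x = refl
∶-other {suc x} {suc y} M y≢x = ∶-other M (λ eq → y≢x (cong suc eq))

∶-+ : ∀ p x M y → ((p + x) ∶ M) (p + y) ≡ (x ∶ M) y
∶-+ zero    x M y = refl
∶-+ (suc p) x M y = ∶-+ p x M y

∶-cong : ∀ x {M M′} → M ≈M M′ → (x ∶ M) ≈E (x ∶ M′)
∶-cong x e y with y ≡ᵇ x
... | true  = e
... | false = []≈

∶-[] : ∀ x → (x ∶ []) ≈E empty
∶-[] x y with y ≡ᵇ x
... | true  = []≈
... | false = []≈

∶-++ : ∀ x A B → ((x ∶ A) +ᵉ (x ∶ B)) ≈E (x ∶ (A ++ B))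
∶-++ x A B y with y ≡ᵇ x
... | true  = ≈M-refl
... | false = []≈

≈E-∶-at : ∀ {Γ x M} → Γ ≈E (x ∶ M) → Γ x ≈M M
≈E-∶-at {x = x} {M} e = ≈M-trans (e x) (≈M-reflexive (∶-self x M))

≈E-∶⇒≡ : ∀ {Γ x M} → Γ ≈E (x ∶ M) → ∀ y → Γ y ≡ (x ∶ Γ x) y
≈E-∶⇒≡ {Γ} {x} e y with y ≟ x
... | yes refl = sym (∶-self x (Γ x))
... | no  y≢x  =
  trans (≈M-[]ʳ (≈M-trans (e y) (≈M-reflexive (∶-other _ y≢x)))) (sym (∶-other _ y≢x))

-- Typing of t•, closed under multiset equality of environments and types; the
-- extra index is the size of the derivation, which decreases along head reduction.
infix 4 _⊩[_,_]_∶L_ _⊩[_,_]_∶M_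

mutual
  data _⊩[_,_]_∶L_ : Env → ℕ → ℕ → Term → LType → Set where
    ⊩ax  : ∀ {Γ x L} → Γ ≈E (x ∶ (L ∷ [])) → Γ ⊩[ 0 , 1 ] var x ∶L L
    ⊩lam : ∀ {Γ Δ k s t L M} → Γ ⊩[ k , s ] t ∶L L → Δ ≈E drop0 Γ → M ≈M Γ 0 →
           Δ ⊩[ k , suc s ] lam t ∶L arr M • L
    ⊩app : ∀ {Γ Δ Θ k₁ k₂ s₁ s₂ t u M c L} →
           Γ ⊩[ k₁ , s₁ ] t ∶L arr M c L → Δ ⊩[ k₂ , s₂ ] u ∶M M → Θ ≈E (Γ +ᵉ Δ) →
           Θ ⊩[ cost c • (k₁ + k₂) , suc (s₁ + s₂) ] app t u ∶L L

  data _⊩[_,_]_∶M_ : Env → ℕ → ℕ → Term → MType → Set where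
    ⊩[] : ∀ {Γ t} → Γ ≈E empty → Γ ⊩[ 0 , 0 ] t ∶M []
    ⊩∷  : ∀ {Γ Δ Θ k₁ k₂ s₁ s₂ t L N₁ N₂} →
          Γ ⊩[ k₁ , s₁ ] t ∶L L → Δ ⊩[ k₂ , s₂ ] t ∶M (N₁ ++ N₂) → Θ ≈E (Γ +ᵉ Δ) →
          Θ ⊩[ k₁ + k₂ , s₁ + s₂ ] t ∶M (N₁ ++ L ∷ N₂)

⊩L-resp-≈E : ∀ {Γ Γ′ k s t L} → Γ ≈E Γ′ → Γ ⊩[ k , s ] t ∶L L → Γ′ ⊩[ k , s ] t ∶L L
⊩L-resp-≈E e (⊩ax f)       = ⊩ax (≈E-trans (≈E-sym e) f)
⊩L-resp-≈E e (⊩lam d f m)  = ⊩lam d (≈E-trans (≈E-sym e) f) m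
⊩L-resp-≈E e (⊩app d d′ f) = ⊩app d d′ (≈E-trans (≈E-sym e) f)

⊩L-resp-≈L : ∀ {Γ k s t L L′} → L ≈L L′ → Γ ⊩[ k , s ] t ∶L L → Γ ⊩[ k , s ] t ∶L L′
⊩L-resp-≈L q          (⊩ax {x = x} e) = ⊩ax (≈E-trans e (∶-cong x (∷≈ {N₁ = []} q []≈)))
⊩L-resp-≈L (arr≈ m q) (⊩lam d e m′)   = ⊩lam (⊩L-resp-≈L q d) e (≈M-trans (≈M-sym m) m′)
⊩L-resp-≈L q          (⊩app d d′ e)   = ⊩app (⊩L-resp-≈L (arr≈ ≈M-refl q) d) d′ e

⊩M-resp-≈M : ∀ {Γ k s t M M′} → M ≈M M′ → Γ ⊩[ k , s ] t ∶M M → Γ ⊩[ k , s ] t ∶M M′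
⊩M-resp-≈M q (⊩[] e) with ≈M-[]ˡ q
... | refl = ⊩[] e
⊩M-resp-≈M q (⊩∷ {N₁ = N₁} d d′ e) with ≈M-remove N₁ q
... | _ , _ , _ , refl , e′ , r′ = ⊩∷ (⊩L-resp-≈L e′ d) (⊩M-resp-≈M r′ d′) e

mutual
  ⊢L⇒⊩L : ∀ t {Γ k L} → Γ ⊢[ k ] paint t ∶L L → Σ ℕ λ s → Γ ⊩[ k , s ] t ∶L L
  ⊢L⇒⊩L (var x)   ax = 1 , ⊩ax ≈E-refl
  ⊢L⇒⊩L (lam t)   (lm d) with ⊢L⇒⊩L t d
  ... | s , d′ = suc s , ⊩lam d′ ≈E-refl ≈M-refl
  ⊢L⇒⊩L (app t u) (ap d du e) with ⊢L⇒⊩L t d | ⊢M⇒⊩M u du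
  ... | s₁ , d₁ | s₂ , d₂ = suc (s₁ + s₂) , ⊩app d₁ (⊩M-resp-≈M e d₂) ≈E-refl

  ⊢M⇒⊩M : ∀ t {Γ k M} → Γ ⊢[ k ] paint t ∶M M → Σ ℕ λ s → Γ ⊩[ k , s ] t ∶M M
  ⊢M⇒⊩M t many[] = 0 , ⊩[] ≈E-refl
  ⊢M⇒⊩M t (many∷ d ds) with ⊢L⇒⊩L t d | ⊢M⇒⊩M t ds
  ... | s₁ , d₁ | s₂ , d₂ = s₁ + s₂ , ⊩∷ {N₁ = []} d₁ d₂ ≈E-refl

⊩L-cost : ∀ {Γ k k′ s t L} → k ≡ k′ → Γ ⊩[ k , s ] t ∶L L → Γ ⊩[ k′ , s ] t ∶L L
⊩L-cost refl d = d

⊩M-cost : ∀ {Γ k k′ s t M} → k ≡ k′ → Γ ⊩[ k , s ] t ∶M M → Γ ⊩[ k′ , s ] t ∶M M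
⊩M-cost refl d = d

⊩M-[]⁻ : ∀ {Γ k s t M} → Γ ⊩[ k , s ] t ∶M M → M ≡ [] → Γ ≈E empty × k ≡ 0 × s ≡ 0
⊩M-[]⁻ (⊩[] e)                   _  = e , refl , refl
⊩M-[]⁻ (⊩∷ {N₁ = []}    _ _ _) ()
⊩M-[]⁻ (⊩∷ {N₁ = _ ∷ _} _ _ _) ()

⊩M-[-]⁻ : ∀ {Γ k s t M L} → Γ ⊩[ k , s ] t ∶M M → M ≡ L ∷ [] → Γ ⊩[ k , s ] t ∶L L
⊩M-[-]⁻ (⊩∷ {k₁ = k₁} {s₁ = s₁} {N₁ = []} {N₂ = []} d d′ e) refl with ⊩M-[]⁻ d′ refl
... | e′ , refl , refl rewrite +-identityʳ k₁ | +-identityʳ s₁ =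
  ⊩L-resp-≈E (≈E-sym (≈E-trans e (≈E-trans (+ᵉ-cong ≈E-refl e′) +ᵉ-identityʳ))) d
⊩M-[-]⁻ (⊩∷ {N₁ = []} {N₂ = _ ∷ _} _ _ _) ()
⊩M-[-]⁻ (⊩∷ {N₁ = _ ∷ []}          _ _ _) ()
⊩M-[-]⁻ (⊩∷ {N₁ = _ ∷ _ ∷ _}       _ _ _) ()

data _⊩[_,_]_∶M_⊕_ (Γ : Env) : ℕ → ℕ → Term → MType → MType → Set where
  split : ∀ {Γ₁ Γ₂ k₁ k₂ s₁ s₂ t M₁ M₂} →
          Γ₁ ⊩[ k₁ , s₁ ] t ∶M M₁ → Γ₂ ⊩[ k₂ , s₂ ] t ∶M M₂ → Γ ≈E (Γ₁ +ᵉ Γ₂) →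
          Γ ⊩[ k₁ + k₂ , s₁ + s₂ ] t ∶M M₁ ⊕ M₂

⊩M-split : ∀ M₁ {M₂ Θ k s t M} → Θ ⊩[ k , s ] t ∶M M → M ≡ M₁ ++ M₂ →
  Θ ⊩[ k , s ] t ∶M M₁ ⊕ M₂
⊩M-split []      {[]}    (⊩[] e) refl = split (⊩[] ≈E-refl) (⊩[] ≈E-refl) e
⊩M-split []      {_ ∷ _} (⊩[] e) ()
⊩M-split (_ ∷ _)         (⊩[] e) ()
⊩M-split M₁ {M₂} {Θ} {t = t} (⊩∷ {Γ = Γ} {k₁ = k₁} {s₁ = s₁} {N₁ = N₁} d d′ e) eq
  with split-++-∷ N₁ M₁ eq
... | inj₁ (C , refl , refl) with ⊩M-split (N₁ ++ C) d′ (sym (++-assoc N₁ C M₂))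
...   | split {Γ₁ = Γ₁} {Γ₂} {ka} {kb} {sa} {sb} d₁ d₂ e′ =
  ≡.subst₂ (λ k s → Θ ⊩[ k , s ] t ∶M M₁ ⊕ M₂) (+-assoc k₁ ka kb) (+-assoc s₁ sa sb)
    (split (⊩∷ d d₁ ≈E-refl) d₂
      (≈E-trans e (≈E-trans (+ᵉ-cong ≈E-refl e′) (≈E-sym (+ᵉ-assoc Γ Γ₁ Γ₂)))))
⊩M-split M₁ {M₂} {Θ} {t = t} (⊩∷ {Γ = Γ} {k₁ = k₁} {s₁ = s₁} {N₂ = N₂} d d′ e) eq
  | inj₂ (B , refl , refl) with ⊩M-split M₁ d′ (++-assoc M₁ B N₂)
...   | split {Γ₁ = Γ₁} {Γ₂} {ka} {kb} {sa} {sb} d₁ d₂ e′ =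
  ≡.subst₂ (λ k s → Θ ⊩[ k , s ] t ∶M M₁ ⊕ M₂) (ℕ+.x∙yz≈y∙xz ka k₁ kb) (ℕ+.x∙yz≈y∙xz sa s₁ sb)
    (split d₁ (⊩∷ {N₁ = B} d d₂ ≈E-refl)
      (≈E-trans e (≈E-trans (+ᵉ-cong ≈E-refl e′) (+ᵉ.x∙yz≈y∙xz Γ Γ₁ Γ₂))))

-- Weakening and substitution

punchIn : ℕ → ℕ → ℕ
punchIn zero    y       = suc y
punchIn (suc i) zero    = zero
punchIn (suc i) (suc y) = suc (punchIn i y)

insertEmpty : ℕ → Env → Env
insertEmpty zero    Γ zero    = []
insertEmpty zero    Γ (suc y) = Γ y
insertEmpty (suc i) Γ zero    = Γ 0
insertEmpty (suc i) Γ (suc y) = insertEmpty i (drop0 Γ) y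

insertEmpty-cong : ∀ i {Γ Γ′} → Γ ≈E Γ′ → insertEmpty i Γ ≈E insertEmpty i Γ′
insertEmpty-cong zero    e zero    = []≈
insertEmpty-cong zero    e (suc y) = e y
insertEmpty-cong (suc i) e zero    = e 0
insertEmpty-cong (suc i) e (suc y) = insertEmpty-cong i (λ z → e (suc z)) y

insertEmpty-+ᵉ : ∀ i Γ Δ y → insertEmpty i (Γ +ᵉ Δ) y ≡ (insertEmpty i Γ +ᵉ insertEmpty i Δ) y
insertEmpty-+ᵉ zero    Γ Δ zero    = refl
insertEmpty-+ᵉ zero    Γ Δ (suc y) = refl
insertEmpty-+ᵉ (suc i) Γ Δ zero    = refl
insertEmpty-+ᵉ (suc i) Γ Δ (suc y) = insertEmpty-+ᵉ i (drop0 Γ) (drop0 Δ) y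

insertEmpty-empty : ∀ i y → insertEmpty i empty y ≡ []
insertEmpty-empty zero    zero    = refl
insertEmpty-empty zero    (suc y) = refl
insertEmpty-empty (suc i) zero    = refl
insertEmpty-empty (suc i) (suc y) = insertEmpty-empty i y

insertEmpty-∶ : ∀ i x M y → insertEmpty i (x ∶ M) y ≡ (punchIn i x ∶ M) y
insertEmpty-∶ zero    x       M zero    = refl
insertEmpty-∶ zero    x       M (suc y) = refl
insertEmpty-∶ (suc i) zero    M zero    = refl
insertEmpty-∶ (suc i) (suc x) M zero    = refl
insertEmpty-∶ (suc i) zero    M (suc y) = insertEmpty-empty i y
insertEmpty-∶ (suc i) (suc x) M (suc y) = insertEmpty-∶ i x M y

ext-cong : ∀ {ρ ρ′} → (∀ y → ρ y ≡ ρ′ y) → ∀ y → ext ρ y ≡ ext ρ′ y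
ext-cong e zero    = refl
ext-cong e (suc y) = cong suc (e y)

rename-cong : ∀ {ρ ρ′} → (∀ y → ρ y ≡ ρ′ y) → ∀ t → rename ρ t ≡ rename ρ′ t
rename-cong e (var x)   = cong var (e x)
rename-cong e (lam t)   = cong lam (rename-cong (ext-cong e) t)
rename-cong e (app t u) = cong₂ app (rename-cong e t) (rename-cong e u)

ext-punchIn : ∀ i y → ext (punchIn i) y ≡ punchIn (suc i) y
ext-punchIn i zero    = refl
ext-punchIn i (suc y) = refl

mutual
  ⊩L-rename : ∀ i {Γ k s t L} → Γ ⊩[ k , s ] t ∶L L →
    insertEmpty i Γ ⊩[ k , s ] rename (punchIn i) t ∶L L
  ⊩L-rename i (⊩ax {x = x} e) =
    ⊩ax (≈E-trans (insertEmpty-cong i e) (≈E-reflexive (insertEmpty-∶ i x _)))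
  ⊩L-rename i (⊩lam {t = t} d e m) =
    ⊩lam (≡.subst (λ t′ → _ ⊩[ _ , _ ] t′ ∶L _) (sym (rename-cong (ext-punchIn i) t))
            (⊩L-rename (suc i) d))
         (insertEmpty-cong i e) m
  ⊩L-rename i (⊩app {Γ = Γ} {Δ = Δ} d du e) =
    ⊩app (⊩L-rename i d) (⊩M-rename i du)
         (≈E-trans (insertEmpty-cong i e) (≈E-reflexive (insertEmpty-+ᵉ i Γ Δ)))

  ⊩M-rename : ∀ i {Γ k s t M} → Γ ⊩[ k , s ] t ∶M M →
    insertEmpty i Γ ⊩[ k , s ] rename (punchIn i) t ∶M M
  ⊩M-rename i (⊩[] e) = ⊩[] (≈E-trans (insertEmpty-cong i e) (≈E-reflexive (insertEmpty-empty i)))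
  ⊩M-rename i (⊩∷ {Γ = Γ} {Δ = Δ} d du e) =
    ⊩∷ (⊩L-rename i d) (⊩M-rename i du)
       (≈E-trans (insertEmpty-cong i e) (≈E-reflexive (insertEmpty-+ᵉ i Γ Δ)))

-- substAt j u replaces the variable j by u lifted over j binders and closes the gap above j.
substAt : ℕ → Term → ℕ → Term
substAt zero    u = subst0 u
substAt (suc j) u = exts (substAt j u)

removeAt : ℕ → Env → Env
removeAt j Γ y = Γ (punchIn j y)

punchIn-view : ∀ j y → y ≡ j ⊎ Σ ℕ λ w → y ≡ punchIn j w
punchIn-view zero    zero    = inj₁ refl
punchIn-view zero    (suc y) = inj₂ (y , refl)
punchIn-view (suc j) zero    = inj₂ (0 , refl)
punchIn-view (suc j) (suc y) with punchIn-view j y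
... | inj₁ refl       = inj₁ refl
... | inj₂ (w , refl) = inj₂ (suc w , refl)

punchIn-≢ : ∀ j w → punchIn j w ≢ j
punchIn-≢ zero    w       ()
punchIn-≢ (suc j) zero    ()
punchIn-≢ (suc j) (suc w) eq = punchIn-≢ j w (suc-injective eq)

substAt-punchIn : ∀ j u w → substAt j u (punchIn j w) ≡ var w
substAt-punchIn zero    u w       = refl
substAt-punchIn (suc j) u zero    = refl
substAt-punchIn (suc j) u (suc w) = cong (rename suc) (substAt-punchIn j u w)

∶-punchIn : ∀ j w M z → (punchIn j w ∶ M) (punchIn j z) ≡ (w ∶ M) z
∶-punchIn zero    w       M z       = refl
∶-punchIn (suc j) zero    M zero    = refl
∶-punchIn (suc j) zero    M (suc z) = refl
∶-punchIn (suc j) (suc w) M zero    = refl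
∶-punchIn (suc j) (suc w) M (suc z) = ∶-punchIn j w M z

removeAt-+ᵉ : ∀ j Γ₁ Γ₂ Δ₁ Δ₂ {Γ Δ} → Γ ≈E (Γ₁ +ᵉ Γ₂) → Δ ≈E (Δ₁ +ᵉ Δ₂) →
  (removeAt j Γ +ᵉ Δ) ≈E ((removeAt j Γ₁ +ᵉ Δ₁) +ᵉ (removeAt j Γ₂ +ᵉ Δ₂))
removeAt-+ᵉ j Γ₁ Γ₂ Δ₁ Δ₂ e f =
  ≈E-trans (+ᵉ-cong (λ y → e (punchIn j y)) f) (+ᵉ.interchange (removeAt j Γ₁) (removeAt j Γ₂) Δ₁ Δ₂)

≤-+-interchange : ∀ {a b} c d e f → a ≤ c + e → b ≤ d + f → a + b ≤ (c + d) + (e + f)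
≤-+-interchange c d e f p q =
  ≤-trans (+-mono-≤ p q) (≤-reflexive (ℕ+.interchange c e d f))

mutual
  subst-⊩L : ∀ j {Γ Δ k k′ s s′ t u L} →
    Γ ⊩[ k , s ] t ∶L L → Δ ⊩[ k′ , s′ ] substAt j u j ∶M Γ j →
    Σ ℕ λ s″ → s″ ≤ s + s′ × (removeAt j Γ +ᵉ Δ) ⊩[ k + k′ , s″ ] subst (substAt j u) t ∶L L
  subst-⊩L j {Γ} {s′ = s′} (⊩ax {x = y} e) du with punchIn-view j y
  ... | inj₁ refl =
    s′ , n≤1+n s′ ,
    ⊩L-resp-≈E (≈E-sym (+ᵉ-cong removed ≈E-refl))
      (⊩M-[-]⁻ (⊩M-resp-≈M (≈E-∶-at e) du) refl)
    where
    removed : removeAt j Γ ≈E empty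
    removed z = ≈M-trans (e (punchIn j z)) (≈M-reflexive (∶-other _ (punchIn-≢ j z)))
  ... | inj₂ (w , refl)
    with ⊩M-[]⁻ du (≈M-[]ʳ (≈M-trans (e j) (≈M-reflexive (∶-other _ (≢-sym (punchIn-≢ j w))))))
  ...   | eΔ , refl , refl =
    1 , ≤-refl ,
    ≡.subst (λ t → _ ⊩[ 0 , 1 ] t ∶L _) (sym (substAt-punchIn j _ w))
      (⊩ax (≈E-trans (+ᵉ-cong remaining eΔ) +ᵉ-identityʳ))
    where
    remaining : removeAt j Γ ≈E (w ∶ _)
    remaining z = ≈M-trans (e (punchIn j z)) (≈M-reflexive (∶-punchIn j w _ z))
  subst-⊩L j (⊩lam {Γ = Γ₁} d e m) du
    with subst-⊩L (suc j) d (⊩M-resp-≈M (e j) (⊩M-rename 0 du))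
  ... | s″ , le , d′ =
    suc s″ , s≤s le ,
    ⊩lam d′ (+ᵉ-cong (λ y → e (punchIn j y)) ≈E-refl)
         (≈M-trans m (≈M-reflexive (sym (++-identityʳ (Γ₁ 0)))))
  subst-⊩L j (⊩app {Γ = Γ₁} {Γ₂} {k₁ = k₁} {k₂} {s₁ = s₁} {s₂} {c = c} d dm e) du
    with ⊩M-split (Γ₁ j) (⊩M-resp-≈M (e j) du) refl
  ... | split {Δ₁} {Δ₂} {ka} {kb} {sa} {sb} du₁ du₂ e′ with subst-⊩L j d du₁ | subst-⊩M j dm du₂
  ... | s₁′ , le₁ , d₁ | s₂′ , le₂ , d₂ =
    suc (s₁′ + s₂′) , s≤s (≤-+-interchange s₁ s₂ sa sb le₁ le₂) ,
    ⊩L-cost cost-eq (⊩app d₁ d₂ (removeAt-+ᵉ j Γ₁ Γ₂ Δ₁ Δ₂ e e′))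
    where
    cost-eq : cost c • ((k₁ + ka) + (k₂ + kb)) ≡ cost c • (k₁ + k₂) + (ka + kb)
    cost-eq = trans (cong (cost c •) (ℕ+.interchange k₁ ka k₂ kb))
                    (sym (cost-•-+ c (k₁ + k₂) (ka + kb)))

  subst-⊩M : ∀ j {Γ Δ k k′ s s′ t u M} →
    Γ ⊩[ k , s ] t ∶M M → Δ ⊩[ k′ , s′ ] substAt j u j ∶M Γ j →
    Σ ℕ λ s″ → s″ ≤ s + s′ × (removeAt j Γ +ᵉ Δ) ⊩[ k + k′ , s″ ] subst (substAt j u) t ∶M M
  subst-⊩M j (⊩[] e) du with ⊩M-[]⁻ du (≈M-[]ʳ (e j))
  ... | eΔ , refl , refl =
    0 , ≤-refl , ⊩[] (≈E-trans (+ᵉ-cong (λ y → e (punchIn j y)) eΔ) +ᵉ-identityʳ)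
  subst-⊩M j (⊩∷ {Γ = Γ₁} {Γ₂} {k₁ = k₁} {k₂} {s₁ = s₁} {s₂} d dm e) du
    with ⊩M-split (Γ₁ j) (⊩M-resp-≈M (e j) du) refl
  ... | split {Δ₁} {Δ₂} {ka} {kb} {sa} {sb} du₁ du₂ e′ with subst-⊩L j d du₁ | subst-⊩M j dm du₂
  ... | s₁′ , le₁ , d₁ | s₂′ , le₂ , d₂ =
    s₁′ + s₂′ , ≤-+-interchange s₁ s₂ sa sb le₁ le₂ ,
    ⊩M-cost (ℕ+.interchange k₁ ka k₂ kb)
      (⊩∷ d₁ d₂ (removeAt-+ᵉ j Γ₁ Γ₂ Δ₁ Δ₂ e e′))

-- Subject reduction and head normalisation

⊩L-β : ∀ {Γ k s t u L} → Γ ⊩[ k , s ] app (lam t) u ∶L L →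
  Σ ℕ λ s′ → s′ < s × Γ ⊩[ k , s′ ] t [ u ] ∶L L
⊩L-β (⊩app (⊩lam d e₁ m₁) du e) with subst-⊩L 0 d (⊩M-resp-≈M m₁ du)
... | s″ , le , d′ =
  s″ , s≤s (m≤n⇒m≤1+n le) , ⊩L-resp-≈E (≈E-sym (≈E-trans e (+ᵉ-cong e₁ ≈E-refl))) d′

mutual
  ⊩L-→β : ∀ {Γ k s t t′ L} → t →β t′ → Γ ⊩[ k , s ] t ∶L L →
    Σ ℕ λ s′ → s′ ≤ s × Γ ⊩[ k , s′ ] t′ ∶L L
  ⊩L-→β β d with ⊩L-β d
  ... | s′ , lt , d′ = s′ , <⇒≤ lt , d′
  ⊩L-→β (ξlam r) (⊩lam d e m) with ⊩L-→β r d
  ... | s′ , le , d′ = suc s′ , s≤s le , ⊩lam d′ e m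
  ⊩L-→β (ξl r) (⊩app {s₂ = s₂} d du e) with ⊩L-→β r d
  ... | s′ , le , d′ = suc (s′ + s₂) , s≤s (+-monoˡ-≤ s₂ le) , ⊩app d′ du e
  ⊩L-→β (ξr r) (⊩app {s₁ = s₁} d du e) with ⊩M-→β r du
  ... | s′ , le , du′ = suc (s₁ + s′) , s≤s (+-monoʳ-≤ s₁ le) , ⊩app d du′ e

  ⊩M-→β : ∀ {Γ k s t t′ M} → t →β t′ → Γ ⊩[ k , s ] t ∶M M →
    Σ ℕ λ s′ → s′ ≤ s × Γ ⊩[ k , s′ ] t′ ∶M M
  ⊩M-→β r (⊩[] e) = 0 , ≤-refl , ⊩[] e
  ⊩M-→β r (⊩∷ d dm e) with ⊩L-→β r d | ⊩M-→β r dm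
  ... | s₁ , le₁ , d′ | s₂ , le₂ , dm′ = s₁ + s₂ , +-mono-≤ le₁ le₂ , ⊩∷ d′ dm′ e

⊩L-→β* : ∀ {Γ k s t t′ L} → t →β* t′ → Γ ⊩[ k , s ] t ∶L L →
  Σ ℕ λ s′ → s′ ≤ s × Γ ⊩[ k , s′ ] t′ ∶L L
⊩L-→β* ε        d = _ , ≤-refl , d
⊩L-→β* (r ◅ rs) d with ⊩L-→β r d
... | s₁ , le₁ , d₁ with ⊩L-→β* rs d₁
... | s₂ , le₂ , d₂ = s₂ , ≤-trans le₂ le₁ , d₂

data _→h_ : Term → Term → Set where
  hβ   : ∀ {t u} → app (lam t) u →h (t [ u ])
  hlam : ∀ {t t′} → t →h t′ → lam t →h lam t′
  happ : ∀ {t t′ u} → t →h t′ → app t u →h app t′ u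

→h⇒→β : ∀ {t t′} → t →h t′ → t →β t′
→h⇒→β hβ       = β
→h⇒→β (hlam r) = ξlam (→h⇒→β r)
→h⇒→β (happ r) = ξl (→h⇒→β r)

⊩L-→h : ∀ {Γ k s t t′ L} → t →h t′ → Γ ⊩[ k , s ] t ∶L L →
  Σ ℕ λ s′ → s′ < s × Γ ⊩[ k , s′ ] t′ ∶L L
⊩L-→h hβ d = ⊩L-β d
⊩L-→h (hlam r) (⊩lam d e m) with ⊩L-→h r d
... | s′ , lt , d′ = suc s′ , s≤s lt , ⊩lam d′ e m
⊩L-→h (happ r) (⊩app {s₂ = s₂} d du e) with ⊩L-→h r d
... | s′ , lt , d′ = suc (s′ + s₂) , s≤s (+-monoˡ-≤ s₂ lt) , ⊩app d′ du e

hnf⊎→h : ∀ t →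
  (Σ ℕ λ n → Σ ℕ λ y → Σ (List Term) λ ts → t ≡ hnf n y ts) ⊎ (Σ Term λ t′ → t →h t′)
hnf⊎→h (var x) = inj₁ (0 , x , [] , refl)
hnf⊎→h (lam t) with hnf⊎→h t
... | inj₁ (n , y , ts , refl) = inj₁ (suc n , y , ts , refl)
... | inj₂ (t′ , r)            = inj₂ (lam t′ , hlam r)
hnf⊎→h (app t u) with hnf⊎→h t
... | inj₁ (zero , y , ts , refl)  = inj₁ (0 , y , ts ++ u ∷ [] , sym (foldl-∷ʳ app (var y) u ts))
... | inj₁ (suc n , y , ts , refl) = inj₂ (_ , hβ)
... | inj₂ (t′ , r)                = inj₂ (app t′ u , happ r)

⊩L⇒HasHNF : ∀ {Γ k s t L} → Acc _<_ s → Γ ⊩[ k , s ] t ∶L L → HasHNF t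
⊩L⇒HasHNF {t = t} (acc rs) d with hnf⊎→h t
... | inj₁ (n , y , ts , refl) = n , y , ts , ε
... | inj₂ (t′ , r) with ⊩L-→h r d
...   | s′ , lt , d′ with ⊩L⇒HasHNF (rs lt) d′
...     | n , y , ts , r* = n , y , ts , →h⇒→β r ◅ r*

-- η-expansions of a variable

apps-app≢var : ∀ {x} t u us → apps (app t u) us ≢ var x
apps-app≢var t u []       ()
apps-app≢var t u (u′ ∷ us) = apps-app≢var (app t u) u′ us

var-→β*-hnf : ∀ {x n y us} → var x →β* hnf n y us → n ≡ 0 × y ≡ x × us ≡ []
var-→β*-hnf {n = n} {us = us} rs = hnf≡var n us (→β*-var rs refl)
  where
  →β*-var : ∀ {x a b} → a →β* b → a ≡ var x → b ≡ var x
  →β*-var ε        e    = e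
  →β*-var (() ◅ _) refl

  hnf≡var : ∀ n {x y} us → hnf n y us ≡ var x → n ≡ 0 × y ≡ x × us ≡ []
  hnf≡var zero    []       refl = refl , refl , refl
  hnf≡var zero    (u ∷ us) e    = ⊥-elim (apps-app≢var _ u us e)
  hnf≡var (suc n) us       ()

⊑var⇒η-hnf : ∀ {R t x} → PostFixed R → R t (var x) → HasHNF t →
  Σ ℕ λ p → Σ (List Term) λ ts →
    t →β* hnf p (x + p) ts × Pointwise R ts (map var (downFrom p))
⊑var⇒η-hnf PF r h with PF _ _ r
... | inj₁ ¬h = ⊥-elim (¬h h)
... | inj₂ (n , p , y , ts₁ , ts , us , t→ , x→ , pw₁ , pw₂)
  with var-→β*-hnf {n = n} {y = y} {us = us} x→
...   | refl , refl , refl with pw₁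
...     | [] = p , ts , t→ , pw₂

⊩L-lams⁻ : ∀ p {Γ k s b L} → Γ ⊩[ k , s ] lams p b ∶L L →
  Σ Env λ Θ → Σ (List MType) λ As → Σ LType λ L₀ → Σ ℕ λ s₀ →
    L ≡ arrs• As L₀ × s₀ ≤ s × Θ ⊩[ k , s₀ ] b ∶L L₀ ×
    (∀ y → Γ y ≈M Θ (p + y)) × Pointwise (λ A j → A ≈M Θ j) As (downFrom p)
⊩L-lams⁻ zero d = _ , [] , _ , _ , refl , ≤-refl , d , (λ _ → ≈M-refl) , []
⊩L-lams⁻ (suc p) (⊩lam {Γ = Γ₁} {M = M} d e m) with ⊩L-lams⁻ p d
... | Θ , As , L₀ , s₀ , refl , le , d₀ , eΓ , pw =
  Θ , M ∷ As , L₀ , s₀ , refl , m≤n⇒m≤1+n le , d₀ ,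
  (λ y → ≈M-trans (e y) (≡.subst (λ z → Γ₁ (suc y) ≈M Θ z) (+-suc p y) (eΓ (suc y)))) ,
  ≈M-trans m (≡.subst (λ z → Γ₁ 0 ≈M Θ z) (+-identityʳ p) (eΓ 0)) ∷ pw

data Spine : Env → ℕ → ℕ → List Term → LType → LType → Set where
  done : ∀ {Θ s L} → Θ ≈E empty → Spine Θ 0 s [] L L
  arg  : ∀ {Δ Θ′ Θ k₁ k₂ s₁ s u us M c H L} →
         Δ ⊩[ k₁ , s₁ ] u ∶M M → s₁ < s → Spine Θ′ k₂ s us H L → Θ ≈E (Δ +ᵉ Θ′) →
         Spine Θ (cost c • (k₁ + k₂)) s (u ∷ us) (arr M c H) L

⊩L-apps⁻ : ∀ us f {Θ k s L} → Θ ⊩[ k , s ] apps f us ∶L L →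
  Σ Env λ Θf → Σ ℕ λ kf → Σ ℕ λ sf → Σ LType λ H → Σ Env λ Θa → Σ ℕ λ ka →
    Θf ⊩[ kf , sf ] f ∶L H × sf ≤ s × Spine Θa ka s us H L × Θ ≈E (Θf +ᵉ Θa) × k ≡ kf + ka
⊩L-apps⁻ [] f {Θ} {k} d =
  Θ , k , _ , _ , empty , 0 , d , ≤-refl , done ≈E-refl , ≈E-sym +ᵉ-identityʳ , sym (+-identityʳ k)
⊩L-apps⁻ (u ∷ us) f d with ⊩L-apps⁻ us (app f u) d
... | _ , _ , _ , H , Θa , ka ,
      ⊩app {Γ = Γf} {Δu} {k₁ = kf} {ku} {s₁ = sf} {su} {c = c} df du e , le , spine , e′ , refl =
  Γf , kf , sf , arr _ c H , Δu +ᵉ Θa , cost c • (ku + ka) , df ,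
  ≤-trans (m≤n⇒m≤1+n (m≤m+n sf su)) le ,
  arg du (≤-trans (s≤s (m≤n+m su sf)) le) spine ≈E-refl ,
  ≈E-trans e′ (≈E-trans (+ᵉ-cong e ≈E-refl) (+ᵉ-assoc Γf Δu Θa)) ,
  cost-eq
  where
  open ≡-Reasoning
  cost-eq : cost c • (kf + ku) + ka ≡ kf + cost c • (ku + ka)
  cost-eq = begin
    cost c • (kf + ku) + ka   ≡⟨ cost-•-+ c (kf + ku) ka ⟩
    cost c • (kf + ku + ka)   ≡⟨ cong (cost c •) (+-assoc kf ku ka) ⟩
    cost c • (kf + (ku + ka)) ≡⟨ sym (+-cost-• c kf (ku + ka)) ⟩
    kf + cost c • (ku + ka)   ∎

_∶*_ : List ℕ → List MType → Env
[]       ∶* Ns       = empty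
(j ∷ js) ∶* []       = empty
(j ∷ js) ∶* (N ∷ Ns) = (j ∶ N) +ᵉ (js ∶* Ns)

SameLength : List MType → List ℕ → Set
SameLength = Pointwise (λ _ _ → ⊤)

downFrom-∶*-≥ : ∀ p Ns {z} → p ≤ z → (downFrom p ∶* Ns) z ≡ []
downFrom-∶*-≥ zero    Ns       _   = refl
downFrom-∶*-≥ (suc p) []       _   = refl
downFrom-∶*-≥ (suc p) (N ∷ Ns) p<z = cong₂ _++_ (∶-other N (>⇒≢ p<z)) (downFrom-∶*-≥ p Ns (<⇒≤ p<z))

downFrom-∶*-≈ : ∀ p {Θ : Env} {Ns As : List MType} → SameLength Ns (downFrom p) →
  (∀ j → j < p → Θ j ≈M (downFrom p ∶* Ns) j) →
  Pointwise (λ A j → A ≈M Θ j) As (downFrom p) → Pointwise _≈M_ Ns As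
downFrom-∶*-≈ zero    []        _  []       = []
downFrom-∶*-≈ (suc p) {Θ} {N ∷ Ns} (_ ∷ len) eΘ (q ∷ qs) =
  ≈M-sym (≈M-trans q (≈M-trans (eΘ p ≤-refl) (≈M-reflexive at-p))) ∷ downFrom-∶*-≈ p {Θ} len below qs
  where
  at-p : (p ∶ N) p ++ (downFrom p ∶* Ns) p ≡ N
  at-p = trans (cong₂ _++_ (∶-self p N) (downFrom-∶*-≥ p Ns ≤-refl)) (++-identityʳ N)
  below : ∀ j → j < p → Θ j ≈M (downFrom p ∶* Ns) j
  below j j<p = ≈M-trans (eΘ j (m≤n⇒m≤1+n j<p)) (≈M-reflexive (cong (_++ _) (∶-other N (<⇒≢ j<p))))

η-env : ∀ p x {Γ Θ H Ns} → Θ ≈E (((x + p) ∶ (H ∷ [])) +ᵉ (downFrom p ∶* Ns)) →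
  (∀ y → Γ y ≈M Θ (p + y)) → Γ ≈E (x ∶ (H ∷ []))
η-env p x {H = H} {Ns} eΘ eΓ y = ≈M-trans (eΓ y) (≈M-trans (eΘ (p + y)) (≈M-reflexive shifted))
  where
  open ≡-Reasoning
  shifted : ((x + p) ∶ (H ∷ [])) (p + y) ++ (downFrom p ∶* Ns) (p + y) ≡ (x ∶ (H ∷ [])) y
  shifted = begin
    ((x + p) ∶ (H ∷ [])) (p + y) ++ (downFrom p ∶* Ns) (p + y)
      ≡⟨ cong₂ _++_ (cong (λ z → (z ∶ (H ∷ [])) (p + y)) (+-comm x p))
                    (downFrom-∶*-≥ p Ns (m≤m+n p y)) ⟩
    ((p + x) ∶ (H ∷ [])) (p + y) ++ []
      ≡⟨ ++-identityʳ _ ⟩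
    ((p + x) ∶ (H ∷ [])) (p + y)
      ≡⟨ ∶-+ p x (H ∷ []) y ⟩
    (x ∶ (H ∷ [])) y ∎

η-types : ∀ p x {Θ H Ns As} → SameLength Ns (downFrom p) →
  Θ ≈E (((x + p) ∶ (H ∷ [])) +ᵉ (downFrom p ∶* Ns)) →
  Pointwise (λ A j → A ≈M Θ j) As (downFrom p) → Pointwise _≈M_ Ns As
η-types p x {Θ} {H} {Ns} len eΘ = downFrom-∶*-≈ p {Θ} len below
  where
  below : ∀ j → j < p → Θ j ≈M (downFrom p ∶* Ns) j
  below j j<p = ≈M-trans (eΘ j)
    (≈M-reflexive (cong (_++ _) (∶-other (H ∷ []) (<⇒≢ (<-≤-trans j<p (m≤n+m p x))))))

mutual
  ⊑var-⊩L : ∀ n {R t x Γ k s L} → PostFixed R → R t (var x) → Γ ⊩[ k , s ] t ∶L L → s ≤ n →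
    Σ LType λ L′ → Γ ≈E (x ∶ (L′ ∷ [])) × CommonWhiteningL L′ k L
  ⊑var-⊩L zero    PF r (⊩ax _)      ()
  ⊑var-⊩L zero    PF r (⊩lam _ _ _) ()
  ⊑var-⊩L zero    PF r (⊩app _ _ _) ()
  ⊑var-⊩L (suc n) {x = x} {s = s} PF r d le
    with ⊑var⇒η-hnf PF r (⊩L⇒HasHNF (<-wellFounded s) d)
  ... | p , ts , t→ , pw with ⊩L-→β* t→ d
  ... | s₁ , le₁ , d₁ with ⊩L-lams⁻ p d₁
  ... | Θ , As , L₀ , s₀ , refl , le₀ , d₀ , eΓ , pwA with ⊩L-apps⁻ ts (var (x + p)) d₀
  ... | _ , _ , _ , H , Θa , ka , ⊩ax eH , _ , spine , eΘ , refl
    with ⊑var-Spine n PF spine (≤-trans le₀ (≤-trans le₁ le)) pw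
  ... | Ns , len , eΘa , w =
    H , η-env p x eΘ′ eΓ , commonWhiteningL-respʳ (arrs•-cong (η-types p x len eΘ′ pwA)) w
    where
    eΘ′ : Θ ≈E (((x + p) ∶ (H ∷ [])) +ᵉ (downFrom p ∶* Ns))
    eΘ′ = ≈E-trans eΘ (+ᵉ-cong eH eΘa)

  ⊑var-⊩M : ∀ n {R t x Γ k s M} → PostFixed R → R t (var x) → Γ ⊩[ k , s ] t ∶M M → s ≤ n →
    Σ MType λ M′ → Γ ≈E (x ∶ M′) × CommonWhiteningM M′ k M
  ⊑var-⊩M n {x = x} PF r (⊩[] e) le = [] , ≈E-trans e (≈E-sym (∶-[] x)) , commonWhiteningM-[]
  ⊑var-⊩M n {x = x} PF r (⊩∷ {s₁ = s₁} {s₂} {N₁ = N₁} d dm e) le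
    with ⊑var-⊩L n PF r d (≤-trans (m≤m+n s₁ s₂) le) | ⊑var-⊩M n PF r dm (≤-trans (m≤n+m s₂ s₁) le)
  ... | L′ , e₁ , w₁ | M′ , e₂ , w₂ =
    L′ ∷ M′ , ≈E-trans e (≈E-trans (+ᵉ-cong e₁ e₂) (∶-++ x _ _)) , commonWhiteningM-∷ N₁ w₁ w₂

  ⊑var-Spine : ∀ n {R Θ k s us H L js} → PostFixed R → Spine Θ k s us H L → s ≤ suc n →
    Pointwise R us (map var js) →
    Σ (List MType) λ Ns → SameLength Ns js × Θ ≈E (js ∶* Ns) × CommonWhiteningL H k (arrs• Ns L)
  ⊑var-Spine n {js = []} PF (done e) le [] = [] , [] , e , commonWhiteningL-refl _
  ⊑var-Spine n {js = _ ∷ _} PF (arg {c = c} du lt spine e) le (r ∷ rs)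
    with ⊑var-⊩M n PF r du (≤-pred (≤-trans lt le)) | ⊑var-Spine n PF spine le rs
  ... | N′ , eΔ , w₁ | Ns , len , eΘ , w₂ =
    N′ ∷ Ns , tt ∷ len , ≈E-trans e (+ᵉ-cong eΔ eΘ) , commonWhiteningL-arr c w₁ w₂

⊑var-⊢L : ∀ {t x Γ k L} → t ⊑Bη var x → Γ ⊢[ k ] paint t ∶L L →
  Σ LType λ L′ → (∀ y → Γ y ≡ (x ∶ (L′ ∷ [])) y) × CommonWhiteningL L′ k L
⊑var-⊢L {t} {x} (R , PF , r) d with ⊢L⇒⊩L t d
... | s , d′ with ⊑var-⊩L s PF r d′ ≤-refl
... | L′ , e , w with ≈M-[-]ʳ (≈E-∶-at e)
... | L₀ , Γx≡ , q =
  L₀ , (λ y → trans (≈E-∶⇒≡ e y) (cong (λ M → (x ∶ M) y) Γx≡)) , commonWhiteningL-respˡ (≈L-sym q) w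

⊑var-⊢M : ∀ {t x Γ k M} → t ⊑Bη var x → Γ ⊢[ k ] paint t ∶M M →
  Σ MType λ M′ → (∀ y → Γ y ≡ (x ∶ M′) y) × CommonWhiteningM M′ k M
⊑var-⊢M {t} {x} {Γ} (R , PF , r) d with ⊢M⇒⊩M t d
... | s , d′ with ⊑var-⊩M s PF r d′ ≤-refl
... | M′ , e , w = Γ x , ≈E-∶⇒≡ e , commonWhiteningM-respˡ (≈M-sym (≈E-∶-at e)) w

lemma3 : (t : Term) (x : ℕ) → t ⊑Bη var x →
    ((Γ : Env) (k : ℕ) (L : LType) → Γ ⊢[ k ] paint t ∶L L →
      Σ LType λ L' → Σ LType λ L'' → Σ ℕ λ k' → Σ ℕ λ k'' →
        (∀ y → Γ y ≡ (x ∶ (L' ∷ [])) y) ×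
        L'' ≤L[ neg , k' ] L' × L'' ≤L[ pos , k'' ] L × k ≡ k' + k'')
    ×
    ((Γ : Env) (k : ℕ) (M : MType) → Γ ⊢[ k ] paint t ∶M M →
      Σ MType λ M' → Σ MType λ M'' → Σ ℕ λ k' → Σ ℕ λ k'' →
        (∀ y → Γ y ≡ (x ∶ M') y) ×
        M'' ≤M[ neg , k' ] M' × M'' ≤M[ pos , k'' ] M × k ≡ k' + k'')
lemma3 t x t⊑x =
  (λ Γ k L d → let (L′ , Γ≡ , L″ , k′ , k″ , w) = ⊑var-⊢L t⊑x d in L′ , L″ , k′ , k″ , Γ≡ , w) ,
  (λ Γ k M d → let (M′ , Γ≡ , M″ , k′ , k″ , w) = ⊑var-⊢M t⊑x d in M′ , M″ , k′ , k″ , Γ≡ , w)
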